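{- If $(P,\leq)$ and $(P,\preceq)$ are rotation-equivalent finite posets on the same set $P$, then there exist $A,C\subseteq P$ satisfying the conditions for a rotation of $(P,\leq)$ with $\mathfrak R_{A,C}(P,\leq)=(P,\preceq)$. Consequently, for a finite poset, the result of applying two rotations in succession is also obtained by a single rotation.
   Context: For a poset $(P,\leq)$: $x<y$ means $x\le y$, $x\ne y$; $x\perp y$ means incomparable; $X<Y$ means $x<y$ for all $x\in X,y\in Y$. A downset is $X$ with $y<x\in X\Rightarrow y\in X$; an up-set dually. The conditions for a rotation: $A,C$ disjoint, $A$ a downset, $C$ an up-set, $A<C$. With $B=P\setminus(A\cup C)$, $\mathfrak R_{A,C}(P,\leq)$ is $(P,\preceq')$ with $x\preceq' y$ iff: (i) $x,y$ both in $A$, both in $B$ or both in $C$, and $x\le y$; or (ii) $x\in B$, $y\in A$, $x\perp y$; or (iii) $x\in C$, $y\in A$; or (iv) $x\in C$, $y\in B$, $x\perp y$. Two posets on the same set are rotation-equivalent if one can be transformed into the other by a finite sequence of rotations, each applied to the current poset. -}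

module Defs where

open import Data.Nat using (ℕ)
open import Data.Fin using (Fin)
open import Data.Bool using (Bool; true; false; T; _∧_; _∨_; not; if_then_else_)
open import Data.Fin.Subset using (Subset; _∈_; _∉_)
open import Data.Vec using (lookup)
open import Data.Product using (_×_; Σ; ∃)
open import Relation.Binary.PropositionalEquality using (_≡_; _≢_)
open import Relation.Nullary using (¬_)
open import Data.Empty using (⊥)

-- A finite set P is modelled as Fin n; a (decidable) binary relation on it
-- as a Bool-valued function:  x ≤ y  iff  T (R x y).
BRel : ℕ → Set
BRel n = Fin n → Fin n → Bool

module _ {n : ℕ} (R : BRel n) where

  _≤R_ : Fin n → Fin n → Set
  x ≤R y = T (R x y)

  record IsPosetB : Set where
    field
      refl′    : ∀ x → x ≤R x
      antisym′ : ∀ x y → x ≤R y → y ≤R x → x ≡ y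
      trans′   : ∀ x y z → x ≤R y → y ≤R z → x ≤R z

  _<R_ : Fin n → Fin n → Set
  x <R y = x ≤R y × x ≢ y

  SetLT : Subset n → Subset n → Set
  SetLT X Y = ∀ x y → x ∈ X → y ∈ Y → x <R y

  IsDownset : Subset n → Set
  IsDownset X = ∀ x y → y <R x → x ∈ X → y ∈ X

  IsUpset : Subset n → Set
  IsUpset X = ∀ x y → x <R y → x ∈ X → y ∈ X

  Disjoint : Subset n → Subset n → Set
  Disjoint A C = ∀ x → x ∈ A → x ∈ C → ⊥

  RotCond : Subset n → Subset n → Set
  RotCond A C = Disjoint A C × IsDownset A × IsUpset C × SetLT A C

module _ {n : ℕ} where
  memb : Subset n → Fin n → Bool
  memb X x = lookup X x

rotate : ∀ {n} → BRel n → Subset n → Subset n → BRel n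
rotate R A C x y =
     (sameBlock ∧ R x y)
  ∨ (inB x ∧ inA y ∧ incomp)
  ∨ (inC x ∧ inA y)
  ∨ (inC x ∧ inB y ∧ incomp)
  where
  inA inC inB : _ → Bool
  inA z = memb A z
  inC z = memb C z
  inB z = not (memb A z ∨ memb C z)
  sameBlock = (inA x ∧ inA y) ∨ (inB x ∧ inB y) ∨ (inC x ∧ inC y)
  incomp = not (R x y) ∧ not (R y x)

_≐_ : ∀ {n} → BRel n → BRel n → Set
R ≐ S = ∀ x y → R x y ≡ S x y

data RotSeq {n : ℕ} : BRel n → BRel n → Set where
  done : ∀ {R S} → R ≐ S → RotSeq R S
  step : ∀ {R S} (A C : Subset n) → RotCond R A C →
         RotSeq (rotate R A C) S → RotSeq R S

RotEquiv : ∀ {n} → BRel n → BRel n → Set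
RotEquiv R S = RotSeq R S

-- A pair (A , C) satisfying the rotation conditions is the same thing as a
-- "partition" of P into three parts  lower = A < middle = B < upper = C  that is
-- compatible with the order (x < y never goes down a part, and lower < upper
-- entirely); the rotation moves the lower part to the top and the upper part to
-- the bottom.  Both the compatibility and the rotated order are LOCAL: for a pair
-- x ≠ y they only depend on the order relation between x and y and on the parts
-- of x and y.  For two successive rotations with part ranks i₁(x), i₂(x) ∈ {0,1,2}
-- put d(x) = i₁(x) + i₂(x).  Locally one checks that |d(x) - d(y)| ≤ 2, so all
-- values of d lie in one window {b, b+1, b+2}; the partition  x ↦ d(x) - b  is
-- compatible with the original order and its rotation agrees with the composite.
-- The local facts concern finitely many Boolean/part values and are checked by
-- exhaustive evaluation.  Finally a sequence of rotations is collapsed by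
-- induction, starting from the trivial rotation (∅ , ∅).
module Submission where

open import Defs
open import Data.Nat using (ℕ; _+_; _∸_; _≤_; _≤?_; z≤n; s≤s; s≤s⁻¹)
open import Data.Nat.Properties
  using (≤-refl; m≤m+n; +-mono-≤; +-cancelʳ-≤; n≢0⇒n>0; ≤∧≢⇒<)
  renaming (_≟_ to _≟ℕ_)
open import Data.Fin using (Fin; toℕ; zero; suc)
open import Data.Fin.Properties using (any?) renaming (_≟_ to _≟Fin_)
open import Data.Fin.Subset using (Subset; _∈_; _∉_)
open import Data.Bool using (Bool; true; false; T; not; _∧_; _∨_)
open import Data.Bool.Properties using (T?) renaming (_≟_ to _≟Bool_)
open import Data.Unit using (tt)
open import Data.Empty using (⊥; ⊥-elim)
open import Data.Product using (_×_; _,_; proj₁; proj₂; Σ-syntax)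
open import Data.List using (List; []; _∷_; allFin; cartesianProduct)
open import Data.List.Membership.Propositional using () renaming (_∈_ to _∈ₗ_)
open import Data.List.Membership.Propositional.Properties using (∈-cartesianProduct⁺; ∈-allFin)
open import Data.List.Relation.Unary.Any using (here; there)
open import Data.List.Relation.Unary.All using () renaming (lookup to lookupAll)
open import Data.List.Relation.Unary.All.Properties using (all⁺)
open import Data.Bool.ListAction using (all)
open import Data.Vec using (lookup; tabulate)
open import Data.Vec.Properties using ([]=⇒lookup; lookup⇒[]=; lookup∘tabulate)
open import Relation.Binary.PropositionalEquality
open import Relation.Nullary using (¬_; yes; no)
open import Relation.Nullary.Decidable using (Dec; ⌊_⌋; toWitness; ¬?; _×-dec_; _→-dec_)

record Enumerable (A : Set) : Set where
  field
    elements : List A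
    complete : ∀ a → a ∈ₗ elements

open Enumerable ⦃ ... ⦄

-- The three parts of a rotation:  lower = A,  middle = B,  upper = C.
data Part : Set where
  lower middle upper : Part

instance
  enumBool : Enumerable Bool
  enumBool = record
    { elements = true ∷ false ∷ []
    ; complete = λ { true → here refl ; false → there (here refl) } }

  enumPart : Enumerable Part
  enumPart = record
    { elements = lower ∷ middle ∷ upper ∷ []
    ; complete = λ { lower → here refl
                   ; middle → there (here refl)
                   ; upper → there (there (here refl)) } }

  enumFin : ∀ {n} → Enumerable (Fin n)
  enumFin {n} = record { elements = allFin n ; complete = ∈-allFin }

  enum× : ∀ {A B : Set} → ⦃ Enumerable A ⦄ → ⦃ Enumerable B ⦄ → Enumerable (A × B)
  enum× = record
    { elements = cartesianProduct elements elements
    ; complete = λ (a , b) → ∈-cartesianProduct⁺ (complete a) (complete b) }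

byEnumeration : ∀ {A : Set} ⦃ _ : Enumerable A ⦄ (P : A → Set) (P? : ∀ a → Dec (P a)) →
                T (all (λ a → ⌊ P? a ⌋) elements) → ∀ a → P a
byEnumeration P P? checked a =
  toWitness {a? = P? a} (lookupAll (all⁺ (λ a → ⌊ P? a ⌋) elements checked) (complete a))

-- Compatibility of a pair x ≠ y, with r = (x ≤ y), with x ∈ p and y ∈ q:
-- an order relation never leads from a higher part to a lower one, and every
-- element of the lower part lies below every element of the upper part.
ordered : Bool → Part → Part → Bool
ordered r lower  upper  = r
ordered r middle lower  = not r
ordered r upper  lower  = not r
ordered r upper  middle = not r
ordered r _      _      = true

-- The rotated order between x ∈ p and y ∈ q, with r = (x ≤ y) and s = (y ≤ x):
-- within a part it is unchanged, C ≺ A always, and B ≺ A, C ≺ B for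
-- incomparable pairs.
rot : Bool → Bool → Part → Part → Bool
rot r s lower  lower  = r
rot r s middle middle = r
rot r s upper  upper  = r
rot r s middle lower  = not r ∧ not s
rot r s upper  lower  = true
rot r s upper  middle = not r ∧ not s
rot r s _      _      = false

rot-diagonal : ∀ r s p → rot r s p p ≡ r
rot-diagonal r s lower  = refl
rot-diagonal r s middle = refl
rot-diagonal r s upper  = refl

classify : Bool → Bool → Part
classify true  _     = lower
classify false true  = upper
classify false false = middle

part : ∀ {n} → Subset n → Subset n → Fin n → Part
part A C x = classify (memb A x) (memb C x)

-- The rotation of Defs as a function of the six Booleans it inspects:
-- rotate R A C x y  is by definition
-- rotateᵇ (R x y) (R y x) (memb A x) (memb C x) (memb A y) (memb C y).
rotateᵇ : Bool → Bool → Bool → Bool → Bool → Bool → Bool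
rotateᵇ r s ax cx ay cy =
  (sameBlock ∧ r) ∨ (bx ∧ ay ∧ incomp) ∨ (cx ∧ ay) ∨ (cx ∧ by ∧ incomp)
  where
  bx = not (ax ∨ cx)
  by = not (ay ∨ cy)
  sameBlock = (ax ∧ ay) ∨ (bx ∧ by) ∨ (cx ∧ cy)
  incomp = not r ∧ not s

rotateᵇ-parts : ∀ r s ax cx ay cy → T (not (ax ∧ cx)) → T (not (ay ∧ cy)) →
                rotateᵇ r s ax cx ay cy ≡ rot r s (classify ax cx) (classify ay cy)
rotateᵇ-parts r s ax cx ay cy =
  byEnumeration Claim (λ (r , s , ax , cx , ay , cy) →
                         T? (not (ax ∧ cx)) →-dec T? (not (ay ∧ cy)) →-dec
                         rotateᵇ r s ax cx ay cy ≟Bool rot r s (classify ax cx) (classify ay cy))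
                tt (r , s , ax , cx , ay , cy)
  where
  Claim : Bool × Bool × Bool × Bool × Bool × Bool → Set
  Claim (r , s , ax , cx , ay , cy) = T (not (ax ∧ cx)) → T (not (ay ∧ cy)) →
    rotateᵇ r s ax cx ay cy ≡ rot r s (classify ax cx) (classify ay cy)

memb⇒∈ : ∀ {n} {A : Subset n} {x} → memb A x ≡ true → x ∈ A
memb⇒∈ {A = A} {x} = lookup⇒[]= x A

memb⇒∉ : ∀ {n} {A : Subset n} {x} → memb A x ≡ false → x ∉ A
memb⇒∉ a≡false x∈A with trans (sym ([]=⇒lookup x∈A)) a≡false
... | ()

data Place {n} (A C : Subset n) (x : Fin n) : Part → Set where
  in-lower  : x ∈ A → Place A C x lower
  in-middle : x ∉ A → x ∉ C → Place A C x middle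
  in-upper  : x ∉ A → x ∈ C → Place A C x upper

place : ∀ {n} (A C : Subset n) x → Place A C x (part A C x)
place A C x = view
  where
  view : Place A C x (classify (memb A x) (memb C x))
  view with memb A x in a | memb C x in c
  ... | true  | _     = in-lower (memb⇒∈ a)
  ... | false | true  = in-upper (memb⇒∉ a) (memb⇒∈ c)
  ... | false | false = in-middle (memb⇒∉ a) (memb⇒∉ c)

disjoint-memb : ∀ {n} {R : BRel n} {A C} → Disjoint R A C → ∀ x → T (not (memb A x ∧ memb C x))
disjoint-memb {A = A} {C} disjoint x with memb A x in a | memb C x in c
... | true  | true  = disjoint x (memb⇒∈ a) (memb⇒∈ c)
... | true  | false = tt
... | false | _     = tt

rotate-parts : ∀ {n} {R : BRel n} {A C} → Disjoint R A C →
               ∀ x y → rotate R A C x y ≡ rot (R x y) (R y x) (part A C x) (part A C y)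
rotate-parts {R = R} {A} {C} disjoint x y =
  rotateᵇ-parts (R x y) (R y x) (memb A x) (memb C x) (memb A y) (memb C y)
                (disjoint-memb {R = R} disjoint x) (disjoint-memb {R = R} disjoint y)

rotate-diagonal : ∀ {n} {R : BRel n} {A C} → Disjoint R A C → ∀ x → rotate R A C x x ≡ R x x
rotate-diagonal {R = R} {A} {C} disjoint x =
  trans (rotate-parts {R = R} disjoint x x) (rot-diagonal (R x x) (R x x) (part A C x))

refute : ∀ {b} → ¬ T b → T (not b)
refute {true}  ¬b = ¬b tt
refute {false} _  = tt

absurd-not : ∀ {b} → T (not b) → T b → ⊥
absurd-not {true} () _

rotCond⇒ordered : ∀ {n} {R : BRel n} {A C} → RotCond R A C →
                  ∀ x y → x ≢ y → T (ordered (R x y) (part A C x) (part A C y))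
rotCond⇒ordered {R = R} {A} {C} (_ , down , up , below) x y x≢y =
  compatible (place A C x) (place A C y)
  where
  compatible : ∀ {p q} → Place A C x p → Place A C y q → T (ordered (R x y) p q)
  compatible (in-lower x∈A)    (in-upper _ y∈C)  = proj₁ (below x y x∈A y∈C)
  compatible (in-middle x∉A _) (in-lower y∈A)    = refute λ x≤y → x∉A (down y x (x≤y , x≢y) y∈A)
  compatible (in-upper x∉A _)  (in-lower y∈A)    = refute λ x≤y → x∉A (down y x (x≤y , x≢y) y∈A)
  compatible (in-upper _ x∈C)  (in-middle _ y∉C) = refute λ x≤y → y∉C (up x y (x≤y , x≢y) x∈C)
  compatible (in-lower _)      (in-lower _)      = tt
  compatible (in-lower _)      (in-middle _ _)   = tt
  compatible (in-middle _ _)   (in-middle _ _)   = tt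
  compatible (in-middle _ _)   (in-upper _ _)    = tt
  compatible (in-upper _ _)    (in-upper _ _)    = tt

place-unique : ∀ {n} {A C : Subset n} {x p q} → Place A C x p → Place A C x q → p ≡ q
place-unique (in-lower _)      (in-lower _)      = refl
place-unique (in-middle _ _)   (in-middle _ _)   = refl
place-unique (in-upper _ _)    (in-upper _ _)    = refl
place-unique (in-lower x∈A)    (in-middle x∉A _) = ⊥-elim (x∉A x∈A)
place-unique (in-lower x∈A)    (in-upper x∉A _)  = ⊥-elim (x∉A x∈A)
place-unique (in-middle x∉A _) (in-lower x∈A)    = ⊥-elim (x∉A x∈A)
place-unique (in-upper x∉A _)  (in-lower x∈A)    = ⊥-elim (x∉A x∈A)
place-unique (in-middle _ x∉C) (in-upper _ x∈C)  = ⊥-elim (x∉C x∈C)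
place-unique (in-upper _ x∈C)  (in-middle _ x∉C) = ⊥-elim (x∉C x∈C)

ordered⇒rotCond : ∀ {n} {R : BRel n} {A C} → Disjoint R A C →
                  (∀ x y → x ≢ y → T (ordered (R x y) (part A C x) (part A C y))) →
                  RotCond R A C
ordered⇒rotCond {R = R} {A} {C} disjoint ord = disjoint , down , up , below
  where
  ordAt : ∀ x y → x ≢ y → ∀ {p q} → Place A C x p → Place A C y q → T (ordered (R x y) p q)
  ordAt x y x≢y px py =
    subst₂ (λ p q → T (ordered (R x y) p q))
           (place-unique (place A C x) px) (place-unique (place A C y) py) (ord x y x≢y)

  down : IsDownset R A
  down x y (y≤x , y≢x) x∈A = inA (place A C y)
    where
    inA : ∀ {q} → Place A C y q → y ∈ A
    inA (in-lower y∈A)     = y∈A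
    inA py@(in-middle _ _) = ⊥-elim (absurd-not (ordAt y x y≢x py (in-lower x∈A)) y≤x)
    inA py@(in-upper _ _)  = ⊥-elim (absurd-not (ordAt y x y≢x py (in-lower x∈A)) y≤x)

  up : IsUpset R C
  up x y (x≤y , x≢y) x∈C = inC (place A C y)
    where
    px : Place A C x upper
    px = in-upper (λ x∈A → disjoint x x∈A x∈C) x∈C
    inC : ∀ {q} → Place A C y q → y ∈ C
    inC (in-upper _ y∈C)    = y∈C
    inC py@(in-lower _)     = ⊥-elim (absurd-not (ordAt x y x≢y px py) x≤y)
    inC py@(in-middle _ _)  = ⊥-elim (absurd-not (ordAt x y x≢y px py) x≤y)

  below : SetLT R A C
  below x y x∈A y∈C =
    ordAt x y x≢y (in-lower x∈A) (in-upper (λ y∈A → disjoint y y∈A y∈C) y∈C) , x≢y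
    where
    x≢y : x ≢ y
    x≢y refl = disjoint x x∈A y∈C

isLower isUpper : Part → Bool
isLower lower = true
isLower _     = false
isUpper upper = true
isUpper _     = false

lowerSet upperSet : ∀ {n} → (Fin n → Part) → Subset n
lowerSet Q = tabulate (λ x → isLower (Q x))
upperSet Q = tabulate (λ x → isUpper (Q x))

classify-flags : ∀ p → classify (isLower p) (isUpper p) ≡ p
classify-flags lower  = refl
classify-flags middle = refl
classify-flags upper  = refl

part-partition : ∀ {n} (Q : Fin n → Part) x → part (lowerSet Q) (upperSet Q) x ≡ Q x
part-partition Q x =
  trans (cong₂ classify (lookup∘tabulate (λ x → isLower (Q x)) x)
                        (lookup∘tabulate (λ x → isUpper (Q x)) x))
        (classify-flags (Q x))

partition-disjoint : ∀ {n} (R : BRel n) (Q : Fin n → Part) → Disjoint R (lowerSet Q) (upperSet Q)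
partition-disjoint R Q x x∈A x∈C =
  exclusive (Q x) (trans (sym (lookup∘tabulate (λ x → isLower (Q x)) x)) ([]=⇒lookup x∈A))
                  (trans (sym (lookup∘tabulate (λ x → isUpper (Q x)) x)) ([]=⇒lookup x∈C))
  where
  exclusive : ∀ p → isLower p ≡ true → isUpper p ≡ true → ⊥
  exclusive lower  _ ()
  exclusive middle () _
  exclusive upper  () _

partition-rotation : ∀ {n} (R : BRel n) (Q : Fin n → Part) →
  (∀ x y → x ≢ y → T (ordered (R x y) (Q x) (Q y))) →
  RotCond R (lowerSet Q) (upperSet Q) ×
  (∀ x y → rotate R (lowerSet Q) (upperSet Q) x y ≡ rot (R x y) (R y x) (Q x) (Q y))
partition-rotation R Q compatible =
  ordered⇒rotCond disjoint (λ x y x≢y →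
    subst₂ (λ p q → T (ordered (R x y) p q)) (sym (part-partition Q x)) (sym (part-partition Q y))
           (compatible x y x≢y)) ,
  λ x y → trans (rotate-parts {R = R} disjoint x y)
                (cong₂ (rot (R x y) (R y x)) (part-partition Q x) (part-partition Q y))
  where
  disjoint : Disjoint R (lowerSet Q) (upperSet Q)
  disjoint = partition-disjoint R Q

rank : Part → ℕ
rank lower  = 0
rank middle = 1
rank upper  = 2

rank≤2 : ∀ p → rank p ≤ 2
rank≤2 lower  = z≤n
rank≤2 middle = s≤s z≤n
rank≤2 upper  = ≤-refl

depth : Part → Part → ℕ
depth p p′ = rank p + rank p′

-- Inverse of  rank  (values beyond 2 are sent to the upper part).
partAt : ℕ → Part
partAt 0 = lower
partAt 1 = middle
partAt _ = upper

-- Everything known about a pair x ≠ y of a poset, with r = (x ≤ y) and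
-- s = (y ≤ x), when x, y lie in parts p, q of a first rotation and in parts
-- p′, q′ of a second rotation applied to the result.
Admissible : Bool → Bool → Part → Part → Part → Part → Set
Admissible r s p q p′ q′ =
  ¬ (T r × T s) × T (ordered r p q) × T (ordered s q p) ×
  T (ordered (rot r s p q) p′ q′) × T (ordered (rot s r q p) q′ p′)

admissible? : ∀ r s p q p′ q′ → Dec (Admissible r s p q p′ q′)
admissible? r s p q p′ q′ =
  ¬? (T? r ×-dec T? s) ×-dec T? (ordered r p q) ×-dec T? (ordered s q p) ×-dec
  T? (ordered (rot r s p q) p′ q′) ×-dec T? (ordered (rot s r q p) q′ p′)

depth-gap : ∀ r s p q p′ q′ → Admissible r s p q p′ q′ → depth p p′ ≤ depth q q′ + 2
depth-gap r s p q p′ q′ =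
  byEnumeration Claim (λ (r , s , p , q , p′ , q′) →
                         admissible? r s p q p′ q′ →-dec depth p p′ ≤? depth q q′ + 2)
                tt (r , s , p , q , p′ , q′)
  where
  Claim : Bool × Bool × Part × Part × Part × Part → Set
  Claim (r , s , p , q , p′ , q′) = Admissible r s p q p′ q′ → depth p p′ ≤ depth q q′ + 2

InWindow : Fin 3 → ℕ → Set
InWindow b d = toℕ b ≤ d × d ≤ toℕ b + 2

inWindow? : ∀ b d → Dec (InWindow b d)
inWindow? b d = toℕ b ≤? d ×-dec d ≤? toℕ b + 2

shifted : Fin 3 → Part → Part → Part
shifted b p p′ = partAt (depth p p′ ∸ toℕ b)

window-rotation : ∀ r s p q p′ q′ b → Admissible r s p q p′ q′ →
  InWindow b (depth p p′) → InWindow b (depth q q′) →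
  T (ordered r (shifted b p p′) (shifted b q q′)) ×
  rot r s (shifted b p p′) (shifted b q q′) ≡ rot (rot r s p q) (rot s r q p) p′ q′
window-rotation r s p q p′ q′ b =
  byEnumeration Claim (λ (r , s , p , q , p′ , q′ , b) →
    admissible? r s p q p′ q′ →-dec inWindow? b (depth p p′) →-dec inWindow? b (depth q q′) →-dec
    T? (ordered r (shifted b p p′) (shifted b q q′)) ×-dec
    rot r s (shifted b p p′) (shifted b q q′) ≟Bool rot (rot r s p q) (rot s r q p) p′ q′)
    tt (r , s , p , q , p′ , q′ , b)
  where
  Claim : Bool × Bool × Part × Part × Part × Part × Fin 3 → Set
  Claim (r , s , p , q , p′ , q′ , b) =
    Admissible r s p q p′ q′ → InWindow b (depth p p′) → InWindow b (depth q q′) →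
    T (ordered r (shifted b p p′) (shifted b q q′)) ×
    rot r s (shifted b p p′) (shifted b q q′) ≡ rot (rot r s p q) (rot s r q p) p′ q′

window : ∀ {n} (d : Fin n → ℕ) → (∀ x → d x ≤ 4) → (∀ x y → d x ≤ d y + 2) →
         Σ[ b ∈ Fin 3 ] (∀ x → InWindow b (d x))
window d bounded gap with any? (λ z → d z ≟ℕ 0)
... | yes (z , dz≡0) = zero , λ x → z≤n , subst (λ m → d x ≤ m + 2) dz≡0 (gap x z)
... | no no-zero with any? (λ z → d z ≟ℕ 4)
... | yes (z , dz≡4) =
  suc (suc zero) , λ x → +-cancelʳ-≤ 2 2 (d x) (subst (λ m → m ≤ d x + 2) dz≡4 (gap z x)) , bounded x
... | no no-four =
  suc zero , λ x → n≢0⇒n>0 (λ dx≡0 → no-zero (x , dx≡0)) ,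
                   s≤s⁻¹ (≤∧≢⇒< (bounded x) (λ dx≡4 → no-four (x , dx≡4)))

SingleRotation : ∀ {n} → BRel n → BRel n → Set
SingleRotation {n} R S = Σ[ A ∈ Subset n ] Σ[ C ∈ Subset n ] (RotCond R A C × (rotate R A C ≐ S))

module TwoRotations {n} {R : BRel n} (poset : IsPosetB R) {A₁ C₁ A₂ C₂ : Subset n}
                    (cond₁ : RotCond R A₁ C₁) (cond₂ : RotCond (rotate R A₁ C₁) A₂ C₂) where

  R′ : BRel n
  R′ = rotate R A₁ C₁

  P₁ P₂ : Fin n → Part
  P₁ = part A₁ C₁
  P₂ = part A₂ C₂

  R′-parts : ∀ x y → R′ x y ≡ rot (R x y) (R y x) (P₁ x) (P₁ y)
  R′-parts = rotate-parts {R = R} (proj₁ cond₁)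

  admissible-at : ∀ x y → x ≢ y → Admissible (R x y) (R y x) (P₁ x) (P₁ y) (P₂ x) (P₂ y)
  admissible-at x y x≢y =
    (λ (x≤y , y≤x) → x≢y (IsPosetB.antisym′ poset x y x≤y y≤x)) ,
    rotCond⇒ordered cond₁ x y x≢y ,
    rotCond⇒ordered cond₁ y x (≢-sym x≢y) ,
    subst (λ r → T (ordered r (P₂ x) (P₂ y))) (R′-parts x y) (rotCond⇒ordered cond₂ x y x≢y) ,
    subst (λ r → T (ordered r (P₂ y) (P₂ x))) (R′-parts y x) (rotCond⇒ordered cond₂ y x (≢-sym x≢y))

  depthOf : Fin n → ℕ
  depthOf x = depth (P₁ x) (P₂ x)

  depthOf-gap : ∀ x y → depthOf x ≤ depthOf y + 2
  depthOf-gap x y with x ≟Fin y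
  ... | yes refl = m≤m+n (depthOf x) 2
  ... | no x≢y   = depth-gap (R x y) (R y x) (P₁ x) (P₁ y) (P₂ x) (P₂ y) (admissible-at x y x≢y)

  fitting : Σ[ b ∈ Fin 3 ] (∀ x → InWindow b (depthOf x))
  fitting = window depthOf (λ x → +-mono-≤ (rank≤2 (P₁ x)) (rank≤2 (P₂ x))) depthOf-gap

  b : Fin 3
  b = proj₁ fitting

  Q : Fin n → Part
  Q x = shifted b (P₁ x) (P₂ x)

  locally : ∀ x y → x ≢ y →
    T (ordered (R x y) (Q x) (Q y)) ×
    rot (R x y) (R y x) (Q x) (Q y) ≡
    rot (rot (R x y) (R y x) (P₁ x) (P₁ y)) (rot (R y x) (R x y) (P₁ y) (P₁ x)) (P₂ x) (P₂ y)
  locally x y x≢y =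
    window-rotation (R x y) (R y x) (P₁ x) (P₁ y) (P₂ x) (P₂ y) b
                    (admissible-at x y x≢y) (proj₂ fitting x) (proj₂ fitting y)

  composite : SingleRotation R (rotate R′ A₂ C₂)
  composite = lowerSet Q , upperSet Q , proj₁ rotation , agrees
    where
    rotation : RotCond R (lowerSet Q) (upperSet Q) ×
               (∀ x y → rotate R (lowerSet Q) (upperSet Q) x y ≡ rot (R x y) (R y x) (Q x) (Q y))
    rotation = partition-rotation R Q (λ x y x≢y → proj₁ (locally x y x≢y))
    open ≡-Reasoning
    agrees : rotate R (lowerSet Q) (upperSet Q) ≐ rotate R′ A₂ C₂
    agrees x y with x ≟Fin y
    ... | yes refl = begin
      rotate R (lowerSet Q) (upperSet Q) x x ≡⟨ rotate-diagonal {R = R} {lowerSet Q} {upperSet Q} (proj₁ (proj₁ rotation)) x ⟩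
      R x x                                  ≡⟨ sym (rotate-diagonal {R = R} {A₁} {C₁} (proj₁ cond₁) x) ⟩
      R′ x x                                 ≡⟨ sym (rotate-diagonal {R = R′} {A₂} {C₂} (proj₁ cond₂) x) ⟩
      rotate R′ A₂ C₂ x x                    ∎
    ... | no x≢y = begin
      rotate R (lowerSet Q) (upperSet Q) x y ≡⟨ proj₂ rotation x y ⟩
      rot (R x y) (R y x) (Q x) (Q y)        ≡⟨ proj₂ (locally x y x≢y) ⟩
      rot (rot (R x y) (R y x) (P₁ x) (P₁ y)) (rot (R y x) (R x y) (P₁ y) (P₁ x)) (P₂ x) (P₂ y)
        ≡⟨ sym (cong₂ (λ r s → rot r s (P₂ x) (P₂ y)) (R′-parts x y) (R′-parts y x)) ⟩
      rot (R′ x y) (R′ y x) (P₂ x) (P₂ y)    ≡⟨ sym (rotate-parts {R = R′} (proj₁ cond₂) x y) ⟩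
      rotate R′ A₂ C₂ x y                    ∎

single-identity : ∀ {n} (R : BRel n) → SingleRotation R R
single-identity R = lowerSet Q , upperSet Q , partition-rotation R Q (λ _ _ _ → tt)
  where
  Q : Fin _ → Part
  Q _ = middle

rotCond-resp : ∀ {n} {R S : BRel n} {A C} → R ≐ S → RotCond R A C → RotCond S A C
rotCond-resp {R = R} {S} {A} {C} e cond =
  ordered⇒rotCond {R = S} (proj₁ cond) (λ x y x≢y →
    subst (λ r → T (ordered r (part A C x) (part A C y))) (e x y) (rotCond⇒ordered cond x y x≢y))

rotate-resp : ∀ {n} {R S : BRel n} {A C} → R ≐ S → rotate R A C ≐ rotate S A C
rotate-resp {A = A} {C} e x y =
  cong₂ (λ r s → rotateᵇ r s (memb A x) (memb C x) (memb A y) (memb C y)) (e x y) (e y x)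

then-rotate : ∀ {n} {R S : BRel n} {A C} → IsPosetB R →
              SingleRotation R S → RotCond S A C → SingleRotation R (rotate S A C)
then-rotate {R = R} {S} {A} {C} poset (A₁ , C₁ , cond₁ , R₁≐S) cond =
  let A′ , C′ , cond′ , R′≐R₂ = TwoRotations.composite poset cond₁ cond₂
  in  A′ , C′ , cond′ , λ x y → trans (R′≐R₂ x y) (rotate-resp {A = A} {C} R₁≐S x y)
  where
  cond₂ : RotCond (rotate R A₁ C₁) A C
  cond₂ = rotCond-resp {R = S} {rotate R A₁ C₁} {A} {C} (λ x y → sym (R₁≐S x y)) cond

collapse : ∀ {n} {R S U : BRel n} → IsPosetB R →
           SingleRotation R S → RotSeq S U → SingleRotation R U
collapse poset (A , C , cond , rotated≐S) (done S≐U) =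
  A , C , cond , λ x y → trans (rotated≐S x y) (S≐U x y)
collapse poset single (step A C cond rest) = collapse poset (then-rotate poset single cond) rest

corollary3p16 :
  (∀ (n : ℕ) (R S : BRel n) → IsPosetB R → IsPosetB S → RotEquiv R S →
     Σ[ A ∈ Subset n ] Σ[ C ∈ Subset n ] (RotCond R A C × (rotate R A C ≐ S)))
  ×
  (∀ (n : ℕ) (R : BRel n) → IsPosetB R →
     ∀ (A₁ C₁ A₂ C₂ : Subset n) → RotCond R A₁ C₁ → RotCond (rotate R A₁ C₁) A₂ C₂ →
     Σ[ A ∈ Subset n ] Σ[ C ∈ Subset n ]
       (RotCond R A C × (rotate R A C ≐ rotate (rotate R A₁ C₁) A₂ C₂)))
corollary3p16 =
  (λ n R S poset _ equivalent → collapse poset (single-identity R) equivalent) ,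
  (λ n R poset A₁ C₁ A₂ C₂ cond₁ cond₂ → TwoRotations.composite poset cond₁ cond₂)
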